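{- Let $n\ge 1$ and let $\Pi$ be a cuspidal automorphic representation of $\mathrm{GL}_{2n}(\mathbb{A}_{\mathbb{Q}})$ as in the context, with Satake parameters $\alpha_1,\dots,\alpha_{2n}$ at an unramified prime $p$, ordered as in the context. Then there are at most two index sets $I=(i_1,\dots,i_n)$ with $1\le i_1<\dots<i_n\le 2n$ such that $\alpha_I$ is non-critical slope, i.e. such that $r_I<\#\mathrm{Crit}(\Pi)$. Equivalently, there are at most two choices of $p$-stabilisation $\alpha_I$ for which the associated $p$-adic $L$-function is non-critical slope.
   Context: Let $n\ge1$ and let $\Pi$ be a cuspidal automorphic representation of $\mathrm{GL}_{2n}(\mathbb{A}_{\mathbb{Q}})$ which is cohomological with respect to an integral weight $\mu=(\mu_1,\dots,\mu_{2n})\in\mathbb{Z}^{2n}$, and which is the transfer of a globally generic cuspidal automorphic representation of $\mathrm{GSpin}_{2n+1}(\mathbb{A}_{\mathbb{Q}})$. Then $\mu$ is dominant ($\mu_1\ge\dots\ge\mu_{2n}$) and pure: there is $w\in\mathbb{Z}$ with $\mu_i+\mu_{2n+1-i}=w$ for $i=1,\dots,n$. Set $\mathrm{Crit}(\Pi)=\{j\in\mathbb{Z}:\mu_n\ge j\ge\mu_{n+1}\}$. Let $p$ be a prime at which $\Pi$ is unramified and set $h_i=\mu_i+2n-i$ ($i=1,\dots,2n$). There is an unramified character $\lambda_p$ of the diagonal torus $T(\mathbb{Q}_p)$ with $\Pi_p$ isomorphic to the normalised parabolic induction from the upper triangular Borel of $|\cdot|^{(2n-1)/2}\lambda_p$;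 the Satake parameters are $\alpha_i=\lambda_{p,i}(p)$, where $\lambda_{p,i}$ is the $i$-th diagonal component. Fix an isomorphism $\bar{\mathbb{Q}}_p\cong\mathbb{C}$ and let $v_p$ be the $p$-adic valuation with $v_p(p)=1$. The $\alpha_i$ are ordered so that $v_p(\alpha_1)\ge\dots\ge v_p(\alpha_{2n})$ and $\alpha_i\alpha_{2n+1-i}=\lambda$ for a fixed $\lambda$ with $v_p(\lambda)=2n-1+w$ (possible because of the transfer from $\mathrm{GSpin}_{2n+1}$). It is known (Hida, "Newton above Hodge") that for $j=1,\dots,2n$ one has $\sum_{i=1}^{j}v_p(\alpha_{2n+1-i})\ge\sum_{i=1}^{j}h_{2n+1-i}$, with equality for $j=2n$. For $I=(i_1,\dots,i_n)$ with $1\le i_1<\dots<i_n\le 2n$ put $\alpha_I=\alpha_{i_1}\cdots\alpha_{i_n}$ and $r_I=v_p(\alpha_I)-\sum_{i=n+1}^{2n}h_i$; $\alpha_I$ is called non-critical slope if $r_I<\#\mathrm{Crit}(\Pi)$. -}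

module Defs where

open import Data.Nat as ℕ using (ℕ; zero; suc)
open import Data.Integer as ℤ using (ℤ; +_)
open import Data.Rational as ℚ using (ℚ; 0ℚ)
open import Data.Fin using (Fin; zero; suc; toℕ; fromℕ; opposite; _↑ˡ_; _↑ʳ_)
open import Data.Fin.Subset using (Subset)
open import Data.Vec using (lookup)
open import Data.Bool using (Bool; true; false; if_then_else_)

ι : ℤ → ℚ
ι z = z ℚ./ 1

sumFin : ∀ {m} → (Fin m → ℚ) → ℚ
sumFin {zero}  f = 0ℚ
sumFin {suc m} f = f zero ℚ.+ sumFin (λ i → f (suc i))

sumOver : ∀ {m} → Subset m → (Fin m → ℚ) → ℚ
sumOver I f = sumFin (λ i → if lookup I i then f i else 0ℚ)

-- Σ_{i=1}^{j} f_{m+1-i} (1-based), i.e. the sum of the last j entries of f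
sumLast : ∀ {m} → ℕ → (Fin m → ℚ) → ℚ
sumLast {m} j f = sumFin (λ i → if (m ℕ.∸ j) ℕ.≤ᵇ toℕ i then f i else 0ℚ)

idx : ∀ {m} → Fin m → ℕ
idx i = suc (toℕ i)

-- the indices n and n+1 (1-based) inside Fin (n + n), for n = suc k
midL : (k : ℕ) → Fin (suc k ℕ.+ suc k)
midL k = fromℕ k ↑ˡ suc k

midR : (k : ℕ) → Fin (suc k ℕ.+ suc k)
midR k = suc k ↑ʳ zero

hodge : ∀ {N} → (Fin N → ℤ) → Fin N → ℚ
hodge {N} μ i = ι (μ i ℤ.+ (+ N) ℤ.- (+ idx i))

-- #Crit(Π) = #{ j ∈ ℤ : μ_n ≥ j ≥ μ_{n+1} } = μ_n - μ_{n+1} + 1 (μ dominant)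
critCount : (k : ℕ) → (Fin (suc k ℕ.+ suc k) → ℤ) → ℤ
critCount k μ = μ (midL k) ℤ.- μ (midR k) ℤ.+ + 1

-- r_I = v_p(α_I) - Σ_{i=n+1}^{2n} h_i, where v i = v_p(α_i)
slopeR : (k : ℕ) → (Fin (suc k ℕ.+ suc k) → ℤ) → (Fin (suc k ℕ.+ suc k) → ℚ)
       → Subset (suc k ℕ.+ suc k) → ℚ
slopeR k μ v I = sumOver I v ℚ.- sumLast (suc k) (hodge μ)

NonCritical : (k : ℕ) → (Fin (suc k ℕ.+ suc k) → ℤ) → (Fin (suc k ℕ.+ suc k) → ℚ)
            → Subset (suc k ℕ.+ suc k) → Set
NonCritical k μ v I = slopeR k μ v I ℚ.< ι (critCount k μ)

{-# OPTIONS --safe #-}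
module Submission where

-- Write h, v for the Hodge numbers and valuations (0-based here, so the middle indices are k, k+1)
-- and C = v_p(λ), so that v i + v (2n-1-i) = C and, by purity, h k + h (k+1) = C as well.
-- If an n-subset I contains both k and k+1, or some index below k, then Σ_I v is at least C plus
-- the n-2 smallest valuations: pair k with k+1 in the first case; in the second compare the small
-- index with k-1 and use the partner of k-1. Newton-above-Hodge bounds those n-2 valuations below
-- by the matching Hodge numbers, and h is decreasing, so r_I ≥ h k - h (k+1) = #Crit(Π).
-- A non-critical I therefore lies in {k,…,2k+1} and misses k or k+1, which leaves two choices.

open import Defs
open import Data.Nat as ℕ using (ℕ; zero; suc; z≤n; s≤s)
import Data.Nat.Properties as ℕP
open import Data.Integer as ℤ using (ℤ; +_)
import Data.Integer.Properties as ℤP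
open import Data.Integer.Tactic.RingSolver using (solve-∀)
open import Data.Rational as ℚ using (ℚ; 0ℚ; mkℚ)
import Data.Rational.Properties as ℚP
import Data.Nat.Coprimality as Coprime
open import Data.Fin using (Fin; zero; suc; toℕ; fromℕ; fromℕ<; opposite)
import Data.Fin.Properties as FinP
open import Data.Fin.Subset using (Subset; ∣_∣; _∈_; _∉_; _⊆_; ⊤; inside; outside)
open import Data.Fin.Subset.Properties
  using (_∈?_; ∈⊤; ∣⊤∣≡n; ∣p∣≤n; drop-∷-⊆; p⊆q⇒∣p∣≤∣q∣)
open import Data.Vec using ([]; _∷_; _[_]≔_; here; there)
open import Data.Vec.Properties using ([]≔-minimal)
open import Data.Bool using (if_then_else_)
open import Data.Empty using (⊥-elim)
open import Data.Sum using (_⊎_; inj₁; inj₂)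
open import Function using (_∘_)
open import Relation.Nullary using (¬_; yes; no)
open import Relation.Binary.PropositionalEquality
open import Algebra.Properties.Group ℚP.+-0-group using (//-rightDividesˡ)
open import Algebra.Bundles using (CommutativeMonoid)
open import Algebra.Properties.CommutativeSemigroup
  (CommutativeMonoid.commutativeSemigroup ℚP.+-0-commutativeMonoid) using (x∙yz≈y∙xz)

Decreasing : ∀ {m} {A : Set} → (A → A → Set) → (Fin m → A) → Set
Decreasing _≤_ f = ∀ i j → toℕ i ℕ.≤ toℕ j → f j ≤ f i

Decreasing-∘suc : ∀ {m} {A : Set} {_≤_ : A → A → Set} {f : Fin (suc m) → A} →
                  Decreasing _≤_ f → Decreasing _≤_ (f ∘ suc)
Decreasing-∘suc f↓ i j = f↓ (suc i) (suc j) ∘ s≤s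

ι-mkℚ : ∀ z → ι z ≡ mkℚ z 0 (Coprime.sym (Coprime.1-coprimeTo ℤ.∣ z ∣))
ι-mkℚ z = ℚP.↥p/↧p≡p (mkℚ z 0 (Coprime.sym (Coprime.1-coprimeTo ℤ.∣ z ∣)))

ι-+ : ∀ a b → ι (a ℤ.+ b) ≡ ι a ℚ.+ ι b
ι-+ a b = trans (cong ι (sym (cong₂ ℤ._+_ (ℤP.*-identityʳ a) (ℤP.*-identityʳ b))))
               (sym (cong₂ ℚ._+_ (ι-mkℚ a) (ι-mkℚ b)))

ι-neg : ∀ a → ι (ℤ.- a) ≡ ℚ.- ι a
ι-neg a = trans (ι-mkℚ (ℤ.- a)) (trans (neg-mkℚ a) (cong ℚ.-_ (sym (ι-mkℚ a))))
  where
  neg-mkℚ : ∀ a → mkℚ (ℤ.- a) 0 (Coprime.sym (Coprime.1-coprimeTo ℤ.∣ ℤ.- a ∣))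
                ≡ ℚ.- mkℚ a 0 (Coprime.sym (Coprime.1-coprimeTo ℤ.∣ a ∣))
  neg-mkℚ (+ zero)    = refl
  neg-mkℚ (+ suc n)   = refl
  neg-mkℚ ℤ.-[1+ n ] = refl

ι-- : ∀ a b → ι (a ℤ.- b) ≡ ι a ℚ.- ι b
ι-- a b = trans (ι-+ a (ℤ.- b)) (cong (ι a ℚ.+_) (ι-neg b))

ι-mono-≤ : ∀ {a b} → a ℤ.≤ b → ι a ℚ.≤ ι b
ι-mono-≤ {a} {b} a≤b rewrite ι-mkℚ a | ι-mkℚ b =
  ℚ.*≤* (subst₂ ℤ._≤_ (sym (ℤP.*-identityʳ a)) (sym (ℤP.*-identityʳ b)) a≤b)

sumFin-cong : ∀ {m} {f g : Fin m → ℚ} → (∀ i → f i ≡ g i) → sumFin f ≡ sumFin g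
sumFin-cong {zero}  f≗g = refl
sumFin-cong {suc m} f≗g = cong₂ ℚ._+_ (f≗g zero) (sumFin-cong (f≗g ∘ suc))

suc≤ᵇsuc : ∀ a b → (suc a ℕ.≤ᵇ suc b) ≡ (a ℕ.≤ᵇ b)
suc≤ᵇsuc zero    b = refl
suc≤ᵇsuc (suc a) b = refl

sumLast-tail : ∀ {m} j (f : Fin (suc m) → ℚ) → j ℕ.≤ m → sumLast j f ≡ sumLast j (f ∘ suc)
sumLast-tail {m} j f j≤m rewrite ℕP.+-∸-assoc 1 j≤m =
  trans (ℚP.+-identityˡ _) (sumFin-cong (λ i → cong (λ b → if b then f (suc i) else 0ℚ)
                                                      (suc≤ᵇsuc (m ℕ.∸ j) (toℕ i))))

sumLast-all : ∀ {m} (f : Fin m → ℚ) → sumLast m f ≡ sumFin f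
sumLast-all {m} f rewrite ℕP.n∸n≡0 m = refl

sumLast-zero : ∀ {m} (f : Fin m → ℚ) → sumLast 0 f ≡ 0ℚ
sumLast-zero {zero}  f = refl
sumLast-zero {suc m} f = trans (sumLast-tail 0 f z≤n) (sumLast-zero (f ∘ suc))

sumLast-step : ∀ {m} (f : Fin m → ℚ) j (i : Fin m) → suc (toℕ i ℕ.+ j) ≡ m →
               sumLast (suc j) f ≡ f i ℚ.+ sumLast j f
sumLast-step {suc m} f j zero refl = begin
  sumLast (suc m) f                ≡⟨ sumLast-all f ⟩
  f zero ℚ.+ sumFin (f ∘ suc)      ≡⟨ cong (f zero ℚ.+_) (sumLast-all (f ∘ suc)) ⟨
  f zero ℚ.+ sumLast m (f ∘ suc)   ≡⟨ cong (f zero ℚ.+_) (sumLast-tail m f ℕP.≤-refl) ⟨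
  f zero ℚ.+ sumLast m f           ∎
  where open ≡-Reasoning
sumLast-step {suc m} f j (suc i) i+j+1≡m = begin
  sumLast (suc j) f                  ≡⟨ sumLast-tail (suc j) f j<m ⟩
  sumLast (suc j) (f ∘ suc)          ≡⟨ sumLast-step (f ∘ suc) j i (ℕP.suc-injective i+j+1≡m) ⟩
  f (suc i) ℚ.+ sumLast j (f ∘ suc)  ≡⟨ cong (f (suc i) ℚ.+_) (sumLast-tail j f (ℕP.<⇒≤ j<m)) ⟨
  f (suc i) ℚ.+ sumLast j f          ∎
  where
  open ≡-Reasoning
  j<m : suc j ℕ.≤ m
  j<m = subst (suc j ℕ.≤_) (ℕP.suc-injective i+j+1≡m) (s≤s (ℕP.m≤n+m j (toℕ i)))

sumLast-opposite : ∀ {m j} (f : Fin m → ℚ) (i : Fin m) → toℕ i ≡ j →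
                   sumLast (suc j) f ≡ f (opposite i) ℚ.+ sumLast j f
sumLast-opposite {m} f i refl = sumLast-step f (toℕ i) (opposite i) (begin
  suc (toℕ (opposite i) ℕ.+ toℕ i)     ≡⟨ ℕP.+-suc _ (toℕ i) ⟨
  toℕ (opposite i) ℕ.+ suc (toℕ i)     ≡⟨ cong (ℕ._+ suc (toℕ i)) (FinP.opposite-prop i) ⟩
  m ℕ.∸ suc (toℕ i) ℕ.+ suc (toℕ i)    ≡⟨ ℕP.m∸n+n≡m (FinP.toℕ<n i) ⟩
  m                                    ∎)
  where open ≡-Reasoning

sumLast-suc-≤ : ∀ {m j} (f : Fin (suc m) → ℚ) → Decreasing ℚ._≤_ f → j ℕ.≤ m →
                sumLast (suc j) f ℚ.≤ f zero ℚ.+ sumLast j f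
sumLast-suc-≤ {j = j} f f↓ j≤m = begin
  sumLast (suc j) f               ≡⟨ sumLast-opposite f i (FinP.toℕ-fromℕ< (s≤s j≤m)) ⟩
  f (opposite i) ℚ.+ sumLast j f  ≤⟨ ℚP.+-monoˡ-≤ (sumLast j f) (f↓ zero (opposite i) z≤n) ⟩
  f zero ℚ.+ sumLast j f          ∎
  where
  open ℚP.≤-Reasoning
  i = fromℕ< (s≤s j≤m)

-- The |p| smallest values of a decreasing f sit at the last |p| indices.
sumLast-∣p∣≤sumOver : ∀ {m} {f : Fin m → ℚ} → Decreasing ℚ._≤_ f →
                      (p : Subset m) → sumLast ∣ p ∣ f ℚ.≤ sumOver p f
sumLast-∣p∣≤sumOver f↓ [] = ℚP.≤-refl
sumLast-∣p∣≤sumOver {suc m} {f} f↓ (outside ∷ p) = begin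
  sumLast c f                  ≡⟨ sumLast-tail c f (∣p∣≤n p) ⟩
  sumLast c (f ∘ suc)          ≤⟨ sumLast-∣p∣≤sumOver (Decreasing-∘suc {_≤_ = ℚ._≤_} f↓) p ⟩
  sumOver p (f ∘ suc)          ≡⟨ ℚP.+-identityˡ _ ⟨
  0ℚ ℚ.+ sumOver p (f ∘ suc)   ∎
  where
  open ℚP.≤-Reasoning
  c = ∣ p ∣
sumLast-∣p∣≤sumOver {suc m} {f} f↓ (inside ∷ p) = begin
  sumLast (suc c) f                ≤⟨ sumLast-suc-≤ f f↓ (∣p∣≤n p) ⟩
  f zero ℚ.+ sumLast c f           ≡⟨ cong (f zero ℚ.+_) (sumLast-tail c f (∣p∣≤n p)) ⟩
  f zero ℚ.+ sumLast c (f ∘ suc)   ≤⟨ ℚP.+-monoʳ-≤ (f zero)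
                                        (sumLast-∣p∣≤sumOver (Decreasing-∘suc {_≤_ = ℚ._≤_} f↓) p) ⟩
  f zero ℚ.+ sumOver p (f ∘ suc)   ∎
  where
  open ℚP.≤-Reasoning
  c = ∣ p ∣

sumOver-remove : ∀ {m} {p : Subset m} {x} (f : Fin m → ℚ) → x ∈ p →
                 sumOver p f ≡ f x ℚ.+ sumOver (p [ x ]≔ outside) f
sumOver-remove f here = cong (f zero ℚ.+_) (sym (ℚP.+-identityˡ _))
sumOver-remove {p = s ∷ p} {suc x} f (there x∈p) = begin
  g ℚ.+ sumOver p (f ∘ suc)           ≡⟨ cong (g ℚ.+_) (sumOver-remove (f ∘ suc) x∈p) ⟩
  g ℚ.+ (f (suc x) ℚ.+ sumOver p′ f′)  ≡⟨ x∙yz≈y∙xz g (f (suc x)) _ ⟩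
  f (suc x) ℚ.+ (g ℚ.+ sumOver p′ f′)  ∎
  where
  open ≡-Reasoning
  g  = if s then f zero else 0ℚ
  f′ = f ∘ suc
  p′ = p [ x ]≔ outside

∣p∣≡suc∣p-x∣ : ∀ {m} {p : Subset m} {x} → x ∈ p →
              ∣ p ∣ ≡ suc ∣ p [ x ]≔ outside ∣
∣p∣≡suc∣p-x∣ here = refl
∣p∣≡suc∣p-x∣ {p = inside ∷ p}  (there x∈p) = cong suc (∣p∣≡suc∣p-x∣ x∈p)
∣p∣≡suc∣p-x∣ {p = outside ∷ p} (there x∈p) = ∣p∣≡suc∣p-x∣ x∈p

⊆-[]≔outside : ∀ {m} {p q : Subset m} {x} → p ⊆ q → x ∉ p → p ⊆ q [ x ]≔ outside
⊆-[]≔outside {q = q} {x} p⊆q x∉p {y} y∈p =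
  []≔-minimal q y x (λ { refl → x∉p y∈p }) (p⊆q y∈p)

⊆∧∣∣≥⇒≡ : ∀ {m} {p q : Subset m} → p ⊆ q → ∣ q ∣ ℕ.≤ ∣ p ∣ → p ≡ q
⊆∧∣∣≥⇒≡ {p = []}          {[]}          p⊆q q≤p = refl
⊆∧∣∣≥⇒≡ {p = inside ∷ p}  {inside ∷ q}  p⊆q (s≤s q≤p) =
  cong (inside ∷_) (⊆∧∣∣≥⇒≡ (drop-∷-⊆ p⊆q) q≤p)
⊆∧∣∣≥⇒≡ {p = inside ∷ p}  {outside ∷ q} p⊆q q≤p with p⊆q here
... | ()
⊆∧∣∣≥⇒≡ {p = outside ∷ p} {inside ∷ q}  p⊆q q≤p =
  ⊥-elim (ℕP.<-irrefl refl (ℕP.≤-trans q≤p (p⊆q⇒∣p∣≤∣q∣ (drop-∷-⊆ p⊆q))))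
⊆∧∣∣≥⇒≡ {p = outside ∷ p} {outside ∷ q} p⊆q q≤p =
  cong (outside ∷_) (⊆∧∣∣≥⇒≡ (drop-∷-⊆ p⊆q) q≤p)

⊆-fill : ∀ {m} {p q : Subset m} {x} → p ⊆ q → x ∈ q → x ∉ p → ∣ q ∣ ≡ suc ∣ p ∣ →
         p ≡ q [ x ]≔ outside
⊆-fill p⊆q x∈q x∉p ∣q∣≡∣p∣+1 = ⊆∧∣∣≥⇒≡ (⊆-[]≔outside p⊆q x∉p)
  (ℕP.≤-reflexive (ℕP.suc-injective (trans (sym (∣p∣≡suc∣p-x∣ x∈q)) ∣q∣≡∣p∣+1)))

atLeast : ∀ {m} → ℕ → Subset m
atLeast {zero}  a       = []
atLeast {suc m} zero    = ⊤
atLeast {suc m} (suc a) = outside ∷ atLeast a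

∣atLeast∣ : ∀ m a → ∣ atLeast {m} a ∣ ≡ m ℕ.∸ a
∣atLeast∣ zero    a       = sym (ℕP.0∸n≡0 a)
∣atLeast∣ (suc m) zero    = ∣⊤∣≡n (suc m)
∣atLeast∣ (suc m) (suc a) = ∣atLeast∣ m a

∈-atLeast : ∀ {m a} {i : Fin m} → a ℕ.≤ toℕ i → i ∈ atLeast a
∈-atLeast {suc m} {zero}  _         = ∈⊤
∈-atLeast {suc m} {suc a} {suc i} (s≤s a≤i) = there (∈-atLeast a≤i)

opposite-antitone : ∀ {m} {i j : Fin m} → toℕ i ℕ.≤ toℕ j →
                    toℕ (opposite j) ℕ.≤ toℕ (opposite i)
opposite-antitone {m} {i} {j} i≤j = begin
  toℕ (opposite j)   ≡⟨ FinP.opposite-prop j ⟩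
  m ℕ.∸ suc (toℕ j)  ≤⟨ ℕP.∸-monoʳ-≤ m (s≤s i≤j) ⟩
  m ℕ.∸ suc (toℕ i)  ≡⟨ FinP.opposite-prop i ⟨
  toℕ (opposite i)   ∎
  where open ℕP.≤-Reasoning

idx+idx-opposite : ∀ {m} (i : Fin m) → idx i ℕ.+ idx (opposite i) ≡ suc m
idx+idx-opposite {m} i = begin
  idx i ℕ.+ suc (toℕ (opposite i))   ≡⟨ ℕP.+-suc (idx i) _ ⟩
  suc (idx i ℕ.+ toℕ (opposite i))   ≡⟨ cong (λ t → suc (idx i ℕ.+ t)) (FinP.opposite-prop i) ⟩
  suc (idx i ℕ.+ (m ℕ.∸ idx i))      ≡⟨ cong suc (ℕP.m+[n∸m]≡n (FinP.toℕ<n i)) ⟩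
  suc m                              ∎
  where open ≡-Reasoning

hodgeℤ : ∀ {m} → (Fin m → ℤ) → Fin m → ℤ
hodgeℤ {m} μ i = μ i ℤ.+ + m ℤ.- + idx i

hodge-decreasing : ∀ {m} {μ : Fin m → ℤ} → Decreasing ℤ._≤_ μ → Decreasing ℚ._≤_ (hodge μ)
hodge-decreasing {m} μ↓ i j i≤j = ι-mono-≤
  (ℤP.+-mono-≤ (ℤP.+-monoˡ-≤ (+ m) (μ↓ i j i≤j)) (ℤP.neg-mono-≤ (ℤ.+≤+ (s≤s i≤j))))

hodge-+-opposite : ∀ {m} (μ : Fin m → ℤ) (i : Fin m) →
                   hodge μ i ℚ.+ hodge μ (opposite i)
                   ≡ ι ((+ m) ℤ.- + 1 ℤ.+ (μ i ℤ.+ μ (opposite i)))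
hodge-+-opposite {m} μ i = trans (sym (ι-+ (hodgeℤ μ i) (hodgeℤ μ i′))) (cong ι (begin
  hodgeℤ μ i ℤ.+ hodgeℤ μ i′           ≡⟨ rearrange (μ i) (μ i′) (+ m) (+ idx i) (+ idx i′) ⟩
  c ℤ.+ (M+1 ℤ.- (+ idx i ℤ.+ + idx i′)) ≡⟨ cong (λ t → c ℤ.+ (M+1 ℤ.- t)) idx-sum ⟩
  c ℤ.+ (M+1 ℤ.- M+1)                   ≡⟨ cong (λ t → c ℤ.+ t) (ℤP.+-inverseʳ M+1) ⟩
  c ℤ.+ + 0                             ≡⟨ ℤP.+-identityʳ c ⟩
  c                                     ∎))
  where
  open ≡-Reasoning
  i′ = opposite i
  M+1 = + m ℤ.+ + 1
  c = (+ m) ℤ.- + 1 ℤ.+ (μ i ℤ.+ μ i′)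
  idx-sum : + idx i ℤ.+ + idx i′ ≡ M+1
  idx-sum = trans (sym (ℤP.pos-+ (idx i) (idx i′)))
                  (trans (cong +_ (trans (idx+idx-opposite i) (ℕP.+-comm 1 m))) (ℤP.pos-+ m 1))
  rearrange : ∀ x y M a b → (x ℤ.+ M ℤ.- a) ℤ.+ (y ℤ.+ M ℤ.- b)
                          ≡ (M ℤ.- + 1 ℤ.+ (x ℤ.+ y)) ℤ.+ ((M ℤ.+ + 1) ℤ.- (a ℤ.+ b))
  rearrange = solve-∀

hodge-gap : ∀ {m} (μ : Fin m → ℤ) (i j : Fin m) → toℕ j ≡ suc (toℕ i) →
            hodge μ i ℚ.- hodge μ j ≡ ι (μ i ℤ.- μ j ℤ.+ + 1)
hodge-gap {m} μ i j j≡i+1 = trans (sym (ι-- (hodgeℤ μ i) (hodgeℤ μ j))) (cong ι (begin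
  hodgeℤ μ i ℤ.- hodgeℤ μ j
    ≡⟨ cong (λ t → hodgeℤ μ i ℤ.- (μ j ℤ.+ + m ℤ.- + suc t)) j≡i+1 ⟩
  hodgeℤ μ i ℤ.- (μ j ℤ.+ + m ℤ.- (+ 1 ℤ.+ + idx i))
    ≡⟨ cancel (μ i) (μ j) (+ m) (+ idx i) ⟩
  μ i ℤ.- μ j ℤ.+ + 1 ∎))
  where
  open ≡-Reasoning
  -- the first step uses that + suc n and + 1 ℤ.+ + n are definitionally equal
  cancel : ∀ x y M a → (x ℤ.+ M ℤ.- a) ℤ.- (y ℤ.+ M ℤ.- (+ 1 ℤ.+ a)) ≡ x ℤ.- y ℤ.+ + 1
  cancel = solve-∀

toℕ-midL : ∀ k → toℕ (midL k) ≡ k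
toℕ-midL k = trans (FinP.toℕ-↑ˡ (fromℕ k) (suc k)) (FinP.toℕ-fromℕ k)

toℕ-midR : ∀ k → toℕ (midR k) ≡ suc k
toℕ-midR k = trans (FinP.toℕ-↑ʳ (suc k) (zero {k})) (ℕP.+-identityʳ (suc k))

opposite-midL : ∀ k → opposite (midL k) ≡ midR k
opposite-midL k = FinP.toℕ-injective (begin
  toℕ (opposite (midL k))          ≡⟨ FinP.opposite-prop (midL k) ⟩
  n ℕ.+ n ℕ.∸ suc (toℕ (midL k))   ≡⟨ cong (λ t → n ℕ.+ n ℕ.∸ suc t) (toℕ-midL k) ⟩
  n ℕ.+ n ℕ.∸ n                    ≡⟨ ℕP.m+n∸m≡n n n ⟩
  n                                ≡⟨ toℕ-midR k ⟨
  toℕ (midR k)                     ∎)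
  where
  open ≡-Reasoning
  n = suc k

midR≢midL : ∀ k → midR k ≢ midL k
midR≢midL k R≡L =
  ℕP.<-irrefl (trans (sym (toℕ-midL k)) (trans (cong toℕ (sym R≡L)) (toℕ-midR k))) (ℕP.n<1+n k)

pigeonhole₂ : ∀ {A : Set} {a b x y z : A} →
              x ≡ a ⊎ x ≡ b → y ≡ a ⊎ y ≡ b → z ≡ a ⊎ z ≡ b → x ≡ y ⊎ y ≡ z ⊎ x ≡ z
pigeonhole₂ (inj₁ x≡a) (inj₁ y≡a) _          = inj₁ (trans x≡a (sym y≡a))
pigeonhole₂ (inj₂ x≡b) (inj₂ y≡b) _          = inj₁ (trans x≡b (sym y≡b))
pigeonhole₂ _          (inj₁ y≡a) (inj₁ z≡a) = inj₂ (inj₁ (trans y≡a (sym z≡a)))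
pigeonhole₂ _          (inj₂ y≡b) (inj₂ z≡b) = inj₂ (inj₁ (trans y≡b (sym z≡b)))
pigeonhole₂ (inj₁ x≡a) (inj₂ _)   (inj₁ z≡a) = inj₂ (inj₂ (trans x≡a (sym z≡a)))
pigeonhole₂ (inj₂ x≡b) (inj₁ _)   (inj₂ z≡b) = inj₂ (inj₂ (trans x≡b (sym z≡b)))

module NonCriticalSlopes
  (k : ℕ) (μ : Fin (suc k ℕ.+ suc k) → ℤ) (w : ℤ) (v : Fin (suc k ℕ.+ suc k) → ℚ)
  (μ-decreasing : Decreasing ℤ._≤_ μ)
  (μ-pure : ∀ i → toℕ i ℕ.< suc k → μ i ℤ.+ μ (opposite i) ≡ w)
  (v-decreasing : Decreasing ℚ._≤_ v)
  (v-pure : ∀ i → v i ℚ.+ v (opposite i) ≡ ι ((+ (suc k ℕ.+ suc k)) ℤ.- + 1 ℤ.+ w))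
  (newton-above-hodge : ∀ j → 1 ℕ.≤ j → j ℕ.≤ suc k ℕ.+ suc k →
                        sumLast j (hodge μ) ℚ.≤ sumLast j v)
  where

  N : ℕ
  N = suc k ℕ.+ suc k

  C : ℚ
  C = ι ((+ N) ℤ.- + 1 ℤ.+ w)

  L R : Fin N
  L = midL k
  R = midR k

  h : Fin N → ℚ
  h = hodge μ

  k≤N : k ℕ.≤ N
  k≤N = ℕP.≤-trans (ℕP.n≤1+n k) (ℕP.m≤m+n (suc k) (suc k))

  hodge-L+R : h L ℚ.+ h R ≡ C
  hodge-L+R = begin
    h L ℚ.+ h R                                     ≡⟨ cong (λ t → h L ℚ.+ h t) (opposite-midL k) ⟨
    h L ℚ.+ h (opposite L)                          ≡⟨ hodge-+-opposite μ L ⟩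
    ι ((+ N) ℤ.- + 1 ℤ.+ (μ L ℤ.+ μ (opposite L)))  ≡⟨ cong (λ t → ι (+ N ℤ.- + 1 ℤ.+ t)) (μ-pure L L<n) ⟩
    C                                               ∎
    where
    open ≡-Reasoning
    L<n : toℕ L ℕ.< suc k
    L<n = ℕP.≤-reflexive (cong suc (toℕ-midL k))

  v-L+R : v L ℚ.+ v R ≡ C
  v-L+R = trans (cong (λ t → v L ℚ.+ v t) (sym (opposite-midL k))) (v-pure L)

  critCount≡hodge-gap : ι (critCount k μ) ≡ h L ℚ.- h R
  critCount≡hodge-gap = sym (hodge-gap μ L R (trans (toℕ-midR k) (cong suc (sym (toℕ-midL k)))))

  newton-above-hodge′ : ∀ j → j ℕ.≤ N → sumLast j h ℚ.≤ sumLast j v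
  newton-above-hodge′ zero    _   = ℚP.≤-reflexive (trans (sumLast-zero h) (sym (sumLast-zero v)))
  newton-above-hodge′ (suc j) j<N = newton-above-hodge (suc j) (s≤s z≤n) j<N

  beforeL : ∀ {m} → suc m ≡ k → Fin N
  beforeL m+1≡k = fromℕ< (ℕP.≤-trans (ℕP.≤-reflexive m+1≡k) k≤N)

  toℕ-beforeL : ∀ {m} (m+1≡k : suc m ≡ k) → toℕ (beforeL m+1≡k) ≡ m
  toℕ-beforeL _ = FinP.toℕ-fromℕ< _

  critCount+sumLast-hodge≤ : ∀ {m} → suc m ≡ k →
                             ι (critCount k μ) ℚ.+ sumLast (suc k) h ℚ.≤ C ℚ.+ sumLast m v
  critCount+sumLast-hodge≤ {m} m+1≡k = begin
    ι (critCount k μ) ℚ.+ sumLast (suc k) h  ≡⟨ cong₂ ℚ._+_ critCount≡hodge-gap sumLast-split ⟩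
    (h L ℚ.- h R) ℚ.+ (h R ℚ.+ (h q ℚ.+ X))  ≡⟨ ℚP.+-assoc (h L ℚ.- h R) (h R) _ ⟨
    ((h L ℚ.- h R) ℚ.+ h R) ℚ.+ (h q ℚ.+ X)  ≡⟨ cong (ℚ._+ (h q ℚ.+ X)) (//-rightDividesˡ (h R) (h L)) ⟩
    h L ℚ.+ (h q ℚ.+ X)                      ≤⟨ ℚP.+-monoʳ-≤ (h L)
                                                  (ℚP.+-mono-≤ hq≤hR (newton-above-hodge′ m m≤N)) ⟩
    h L ℚ.+ (h R ℚ.+ sumLast m v)            ≡⟨ ℚP.+-assoc (h L) (h R) _ ⟨
    (h L ℚ.+ h R) ℚ.+ sumLast m v            ≡⟨ cong (ℚ._+ sumLast m v) hodge-L+R ⟩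
    C ℚ.+ sumLast m v                        ∎
    where
    open ℚP.≤-Reasoning
    j = beforeL m+1≡k
    q = opposite j
    X = sumLast m h
    sumLast-split : sumLast (suc k) h ≡ h R ℚ.+ (h q ℚ.+ X)
    sumLast-split = trans (sumLast-opposite h L (toℕ-midL k))
      (cong₂ ℚ._+_ (cong h (opposite-midL k))
                   (trans (cong (λ t → sumLast t h) (sym m+1≡k))
                          (sumLast-opposite h j (toℕ-beforeL m+1≡k))))
    j≤L : toℕ j ℕ.≤ toℕ L
    j≤L = subst₂ ℕ._≤_ (sym (toℕ-beforeL m+1≡k)) (trans m+1≡k (sym (toℕ-midL k)))
                 (ℕP.n≤1+n m)
    hq≤hR : h q ℚ.≤ h R
    hq≤hR = hodge-decreasing μ-decreasing R q
              (subst (λ t → toℕ t ℕ.≤ toℕ q) (opposite-midL k) (opposite-antitone j≤L))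
    m≤N : m ℕ.≤ N
    m≤N = subst (ℕ._≤ N) (toℕ-beforeL m+1≡k) (ℕP.<⇒≤ (FinP.toℕ<n j))

  sumOver≥⇒¬NonCritical : ∀ {m} → suc m ≡ k → (I : Subset N) →
                          C ℚ.+ sumLast m v ℚ.≤ sumOver I v → ¬ NonCritical k μ v I
  sumOver≥⇒¬NonCritical {m} m+1≡k I bound nc = ℚP.<-irrefl refl (begin-strict
    sumOver I v                  ≡⟨ //-rightDividesˡ Sh (sumOver I v) ⟨
    (sumOver I v ℚ.- Sh) ℚ.+ Sh  <⟨ ℚP.+-monoˡ-< Sh nc ⟩
    ι (critCount k μ) ℚ.+ Sh     ≤⟨ critCount+sumLast-hodge≤ m+1≡k ⟩
    C ℚ.+ sumLast m v            ≤⟨ bound ⟩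
    sumOver I v                  ∎)
    where
    open ℚP.≤-Reasoning
    Sh = sumLast (suc k) h

  L∈∧R∈⇒¬NonCritical : (I : Subset N) → ∣ I ∣ ≡ suc k → L ∈ I → R ∈ I → ¬ NonCritical k μ v I
  L∈∧R∈⇒¬NonCritical I ∣I∣≡n L∈I R∈I = sumOver≥⇒¬NonCritical ∣I₂∣+1≡k I (begin
    C ℚ.+ sumLast c v                  ≡⟨ cong (ℚ._+ sumLast c v) v-L+R ⟨
    (v L ℚ.+ v R) ℚ.+ sumLast c v      ≡⟨ ℚP.+-assoc (v L) (v R) _ ⟩
    v L ℚ.+ (v R ℚ.+ sumLast c v)      ≤⟨ ℚP.+-monoʳ-≤ (v L) (ℚP.+-monoʳ-≤ (v R)
                                            (sumLast-∣p∣≤sumOver v-decreasing I₂)) ⟩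
    v L ℚ.+ (v R ℚ.+ sumOver I₂ v)     ≡⟨ cong (v L ℚ.+_) (sumOver-remove v R∈I₁) ⟨
    v L ℚ.+ sumOver I₁ v               ≡⟨ sumOver-remove v L∈I ⟨
    sumOver I v                        ∎)
    where
    open ℚP.≤-Reasoning
    I₁ = I [ L ]≔ outside
    I₂ = I₁ [ R ]≔ outside
    c = ∣ I₂ ∣
    R∈I₁ : R ∈ I₁
    R∈I₁ = []≔-minimal I R L (midR≢midL k) R∈I
    ∣I₂∣+1≡k : suc c ≡ k
    ∣I₂∣+1≡k = ℕP.suc-injective
      (trans (sym (trans (∣p∣≡suc∣p-x∣ L∈I) (cong suc (∣p∣≡suc∣p-x∣ R∈I₁)))) ∣I∣≡n)

  below-L∈⇒¬NonCritical : (I : Subset N) → ∣ I ∣ ≡ suc k →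
                          ∀ {x} → x ∈ I → toℕ x ℕ.< k → ¬ NonCritical k μ v I
  below-L∈⇒¬NonCritical I ∣I∣≡n {x} x∈I x<k = sumOver≥⇒¬NonCritical m+1≡k I (begin
    C ℚ.+ sumLast m v                         ≡⟨ cong (ℚ._+ sumLast m v) (v-pure j) ⟨
    (v j ℚ.+ v (opposite j)) ℚ.+ sumLast m v  ≡⟨ ℚP.+-assoc (v j) (v (opposite j)) _ ⟩
    v j ℚ.+ (v (opposite j) ℚ.+ sumLast m v)  ≡⟨ cong (v j ℚ.+_) (sumLast-opposite v j j≡m) ⟨
    v j ℚ.+ sumLast (suc m) v                 ≡⟨ cong (λ t → v j ℚ.+ sumLast t v) m+1≡∣I₁∣ ⟩
    v j ℚ.+ sumLast ∣ I₁ ∣ v                  ≤⟨ ℚP.+-mono-≤ (v-decreasing x j x≤j)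
                                                   (sumLast-∣p∣≤sumOver v-decreasing I₁) ⟩
    v x ℚ.+ sumOver I₁ v                      ≡⟨ sumOver-remove v x∈I ⟨
    sumOver I v                               ∎)
    where
    open ℚP.≤-Reasoning
    m = ℕ.pred k
    m+1≡k : suc m ≡ k
    m+1≡k = ℕP.suc-pred k {{ℕ.>-nonZero (ℕP.<-≤-trans (s≤s z≤n) x<k)}}
    j = beforeL m+1≡k
    j≡m : toℕ j ≡ m
    j≡m = toℕ-beforeL m+1≡k
    x≤j : toℕ x ℕ.≤ toℕ j
    x≤j = subst (toℕ x ℕ.≤_) (sym j≡m) (ℕP.≤-pred (subst (toℕ x ℕ.<_) (sym m+1≡k) x<k))
    I₁ = I [ x ]≔ outside
    m+1≡∣I₁∣ : suc m ≡ ∣ I₁ ∣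
    m+1≡∣I₁∣ = trans m+1≡k (ℕP.suc-injective (trans (sym ∣I∣≡n) (∣p∣≡suc∣p-x∣ x∈I)))

  NonCritical⇒≡atLeast-x : (I : Subset N) → ∣ I ∣ ≡ suc k → NonCritical k μ v I →
                           ∀ {x} → k ℕ.≤ toℕ x → x ∉ I → I ≡ atLeast k [ x ]≔ outside
  NonCritical⇒≡atLeast-x I ∣I∣≡n nc k≤x x∉I = ⊆-fill I⊆atLeast (∈-atLeast k≤x) x∉I (begin
    ∣ atLeast {N} k ∣        ≡⟨ ∣atLeast∣ N k ⟩
    N ℕ.∸ k                  ≡⟨ cong (ℕ._∸ k) (ℕP.+-suc (suc k) k) ⟩
    suc (suc k) ℕ.+ k ℕ.∸ k  ≡⟨ ℕP.m+n∸n≡m (suc (suc k)) k ⟩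
    suc (suc k)              ≡⟨ cong suc ∣I∣≡n ⟨
    suc ∣ I ∣                ∎)
    where
    open ≡-Reasoning
    I⊆atLeast : I ⊆ atLeast k
    I⊆atLeast x∈I = ∈-atLeast (ℕP.≮⇒≥ (λ x<k → below-L∈⇒¬NonCritical I ∣I∣≡n x∈I x<k nc))

  NonCritical-classification : (I : Subset N) → ∣ I ∣ ≡ suc k → NonCritical k μ v I →
                               I ≡ atLeast k [ L ]≔ outside ⊎ I ≡ atLeast k [ R ]≔ outside
  NonCritical-classification I ∣I∣≡n nc with L ∈? I | R ∈? I
  ... | yes L∈I | yes R∈I = ⊥-elim (L∈∧R∈⇒¬NonCritical I ∣I∣≡n L∈I R∈I nc)
  ... | no  L∉I | _       = inj₁ (NonCritical⇒≡atLeast-x I ∣I∣≡n nc k≤L L∉I)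
    where
    k≤L : k ℕ.≤ toℕ L
    k≤L = ℕP.≤-reflexive (sym (toℕ-midL k))
  ... | yes _   | no  R∉I = inj₂ (NonCritical⇒≡atLeast-x I ∣I∣≡n nc k≤R R∉I)
    where
    k≤R : k ℕ.≤ toℕ R
    k≤R = subst (k ℕ.≤_) (sym (toℕ-midR k)) (ℕP.n≤1+n k)

mainTheorem1 : (k : ℕ) (μ : Fin (suc k ℕ.+ suc k) → ℤ) (w : ℤ) (v : Fin (suc k ℕ.+ suc k) → ℚ)
    → (∀ i j → toℕ i ℕ.≤ toℕ j → μ j ℤ.≤ μ i)
    → (∀ i → toℕ i ℕ.< suc k → μ i ℤ.+ μ (opposite i) ≡ w)
    → (∀ i j → toℕ i ℕ.≤ toℕ j → v j ℚ.≤ v i)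
    → (∀ i → v i ℚ.+ v (opposite i) ≡ ι ((+ (suc k ℕ.+ suc k)) ℤ.- + 1 ℤ.+ w))
    → (∀ j → 1 ℕ.≤ j → j ℕ.≤ suc k ℕ.+ suc k → sumLast j (hodge μ) ℚ.≤ sumLast j v)
    → sumLast (suc k ℕ.+ suc k) v ≡ sumLast (suc k ℕ.+ suc k) (hodge μ)
    → (I J K : Subset (suc k ℕ.+ suc k))
    → ∣ I ∣ ≡ suc k → ∣ J ∣ ≡ suc k → ∣ K ∣ ≡ suc k
    → NonCritical k μ v I → NonCritical k μ v J → NonCritical k μ v K
    → I ≡ J ⊎ J ≡ K ⊎ I ≡ K
-- The equality case of Newton-above-Hodge is not needed.
mainTheorem1 k μ w v μ↓ μ-pure v↓ v-pure newton _ I J K ∣I∣ ∣J∣ ∣K∣ ncI ncJ ncK =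
  pigeonhole₂ (NonCritical-classification I ∣I∣ ncI)
              (NonCritical-classification J ∣J∣ ncJ)
              (NonCritical-classification K ∣K∣ ncK)
  where open NonCriticalSlopes k μ w v μ↓ μ-pure v↓ v-pure newton
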